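{- Let $k$ be a natural number. For any natural number $m$, there are at most finitely many terms $\alpha\in OT_0$ with $\alpha<\Omega$ such that $H_\alpha(k)\le m$.
   Context: Ordinal terms. Let $T$ be the set of formal terms generated by: $0,1\in T$; if $\beta\in T$ then $\psi_0\beta,\psi_1\beta,\psi_2\beta\in T$ (these and $1$ are the principal terms); if $\alpha_0\ge\dots\ge\alpha_n$ ($n\ge1$) are principal terms then $\alpha_0+\dots+\alpha_n\in T$. The linear order $<$ on $T$ is generated by: $0<\alpha$ for $\alpha\ne0$; $1<\psi_i\beta$; $\psi_i\alpha<\psi_i\beta$ if $\alpha<\beta$; $\psi_i\alpha<\psi_j\beta$ if $i<j$; sums (a principal term counting as a sum of length one) are compared lexicographically. Abbreviations: $\omega:=\psi_00$, $\Omega:=\psi_10$, $\Omega_2:=\psi_20$; a natural number $n$ is identified with $1+\dots+1$; $\alpha\cdot x$ is the $x$-fold sum. For a set $A$ of terms, $A<\beta$ means every element of $A$ is $<\beta$. Sets $G_0,G_1$: $G_1\alpha=\emptyset$ if $\alpha<\Omega$; $G_1\psi_2\beta=G_1\beta$; $G_1$ of a sum is the union over summands; $G_1\psi_1\beta=\{\beta\}\cup G_1\beta$; $G_1\psi_0\beta=\emptyset$. $G_00=G_01=\emptyset$; $G_0\psi_2\beta=G_0\beta$; $G_0$ of a sum is the union; $G_0\psi_1\beta=G_0\beta$; $G_0\psi_0\beta=\{\beta\}\cup G_0\beta$. $OT\subseteq T$: $0,1\in OT$; $\psi_2\beta\in OT$ if $\beta\in OT$; a sum is in $OT$ if all summands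 are; $\psi_1\beta\in OT$ if $\beta\in OT$ and $G_1\beta<\beta$; $\psi_0\beta\in OT$ if $\beta\in OT$, $G_0\beta<\beta$, $\beta<\Omega_2$. $\varepsilon_{\Omega+1}$ denotes $\psi_1\Omega_2$, and $OT_0:=\{\alpha\in OT:\alpha<\varepsilon_{\Omega+1},\ G_0\alpha<\varepsilon_{\Omega+1}\}$. Fundamental sequences: $tp(0)=0$; $tp(1)=1$, $1[0]=0$; for $\Omega_0:=\omega,\Omega_1:=\Omega,\Omega_2$: $tp(\Omega_i)=\Omega_i$, $\Omega_i[x]=x$; for a sum $\alpha_0+\dots+\alpha_n$ ($n\ge1$): $tp=tp(\alpha_n)$, $(\alpha_0+\dots+\alpha_n)[x]=\alpha_0+\dots+\alpha_{n-1}+\alpha_n[x]$; if $tp(\alpha)=1$: $tp(\psi_i\alpha)=\omega$, $(\psi_i\alpha)[x]=\psi_i(\alpha[0])\cdot x$; if $tp(\alpha)\notin\{0,1\}$ and ($i=2$ or $tp(\alpha)<\Omega_{i+1}$): $tp(\psi_i\alpha)=tp(\alpha)$, $(\psi_i\alpha)[x]=\psi_i(\alpha[x])$; if $tp(\alpha)=\Omega$: $tp(\psi_0\alpha)=\omega$, $(\psi_0\alpha)[x]=\psi_0(\alpha[z_x])$, $z_0=0$, $z_{x+1}=\psi_0(\alpha[z_x])$; if $tp(\alpha)=\Omega_2$: $tp(\psi_1\alpha)=\omega$, $(\psi_1\alpha)[x]=\psi_1(\alpha[z_x])$, $z_0=0$, $z_{x+1}=\psi_1(\alpha[z_x])$.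 Conventions: $0[x]=0$, $(\alpha+1)[x]=\alpha$, if $tp(\alpha)\in\{0,1\}$ then $\alpha[m]=\alpha[0]$. Hardy hierarchy. For $k\ge1$ and $\alpha\in OT_0$, $\alpha<\Omega$: $H_0(k)=k$; $H_{\alpha+1}(k)=H_\alpha(k)\cdot k$; if $tp(\lambda)=\omega$, $H_\lambda(k)=H_{\lambda\{k\}}(k)$ with $\lambda\{0\}=\lambda[0]$, $\lambda\{b+1\}=\lambda[H_{\lambda\{b\}}(k)]$. -}

module Defs where

open import Data.Nat using (ℕ; zero; suc; _*_; _≤_)
open import Data.List using (List; []; _∷_; _++_; _∷ʳ_; replicate; length)
open import Data.List.Relation.Unary.All using (All)
open import Data.List.Relation.Unary.Any using (Any)
open import Data.List.Relation.Unary.Linked using (Linked)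
open import Data.Sum using (_⊎_)
open import Data.Product using (_×_)
open import Relation.Binary.PropositionalEquality using (_≡_; _≢_)

data Ix : Set where
  i0 i1 i2 : Ix

data _<ᵢ_ : Ix → Ix → Set where
  0<1 : i0 <ᵢ i1
  0<2 : i0 <ᵢ i2
  1<2 : i1 <ᵢ i2

-- Raw terms.  `Σ l` represents the sum α₀ + … + αₙ of the list l
-- (well-formedness: length ≥ 2, principal, non-increasing, is imposed in OT).

data Tm : Set where
  𝟎 : Tm
  𝟏 : Tm
  ψ : Ix → Tm → Tm
  Σ : List Tm → Tm

ω Ω Ω₂ εΩ+1 : Tm
ω = ψ i0 𝟎
Ω = ψ i1 𝟎
Ω₂ = ψ i2 𝟎
εΩ+1 = ψ i1 Ω₂

toList : Tm → List Tm
toList 𝟎 = []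
toList (Σ l) = l
toList t = t ∷ []

fromList : List Tm → Tm
fromList [] = 𝟎
fromList (a ∷ []) = a
fromList (a ∷ b ∷ l) = Σ (a ∷ b ∷ l)

num : ℕ → Tm
num n = fromList (replicate n 𝟏)

_·_ : Tm → ℕ → Tm
α · n = fromList (replicate n α)

succT : Tm → Tm
succT α = fromList (toList α ∷ʳ 𝟏)

mutual
  data _<_ : Tm → Tm → Set where
    lex : ∀ {α β} → Lex (toList α) (toList β) → α < β

  data Lex : List Tm → List Tm → Set where
    []<∷  : ∀ {q qs} → Lex [] (q ∷ qs)
    here  : ∀ {p q ps qs} → p <P q → Lex (p ∷ ps) (q ∷ qs)
    there : ∀ {p ps qs} → Lex ps qs → Lex (p ∷ ps) (p ∷ qs)

  data _<P_ : Tm → Tm → Set where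
    1<ψ  : ∀ {i β} → 𝟏 <P ψ i β
    ψ<ψ  : ∀ {i α β} → α < β → ψ i α <P ψ i β
    ψi<ψj : ∀ {i j α β} → i <ᵢ j → ψ i α <P ψ j β

_≥_ : Tm → Tm → Set
α ≥ β = β < α ⊎ β ≡ α

-- G₁, G₀ as membership relations  (γ ∈G₁ α  means  γ ∈ G₁ α)

data _∈G₁_ : Tm → Tm → Set where
  g-ψ2   : ∀ {γ β} → γ ∈G₁ β → γ ∈G₁ ψ i2 β
  g-sum  : ∀ {γ l} → Any (γ ∈G₁_) l → γ ∈G₁ Σ l
  g-ψ1   : ∀ {β} → β ∈G₁ ψ i1 β
  g-ψ1'  : ∀ {γ β} → γ ∈G₁ β → γ ∈G₁ ψ i1 β

data _∈G₀_ : Tm → Tm → Set where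
  g-ψ2   : ∀ {γ β} → γ ∈G₀ β → γ ∈G₀ ψ i2 β
  g-sum  : ∀ {γ l} → Any (γ ∈G₀_) l → γ ∈G₀ Σ l
  g-ψ1   : ∀ {γ β} → γ ∈G₀ β → γ ∈G₀ ψ i1 β
  g-ψ0   : ∀ {β} → β ∈G₀ ψ i0 β
  g-ψ0'  : ∀ {γ β} → γ ∈G₀ β → γ ∈G₀ ψ i0 β

G₁<_ : Tm → Set
G₁< β = ∀ γ → γ ∈G₁ β → γ < β

G₀_<_ : Tm → Tm → Set
G₀ α < β = ∀ γ → γ ∈G₀ α → γ < β

-- Principal terms and OT  (OT ⊆ T: the sum clause includes the T-conditions)

data Principal : Tm → Set where
  p1 : Principal 𝟏
  pψ : ∀ {i β} → Principal (ψ i β)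

data OT : Tm → Set where
  ot0   : OT 𝟎
  ot1   : OT 𝟏
  otψ2  : ∀ {β} → OT β → OT (ψ i2 β)
  otψ1  : ∀ {β} → OT β → G₁< β → OT (ψ i1 β)
  otψ0  : ∀ {β} → OT β → G₀ β < β → β < Ω₂ → OT (ψ i0 β)
  otsum : ∀ {l} → 2 ≤ length l → All Principal l → Linked _≥_ l
          → All OT l → OT (Σ l)

OT₀ : Tm → Set
OT₀ α = OT α × α < εΩ+1 × G₀ α < εΩ+1

-- Fundamental sequences:  Tp α τ  means tp(α) = τ;
-- FS α x β  means  α[x] = β.

-- side condition "i = 2 or tp(α) < Ω_{i+1}"
data LimCond : Ix → Tm → Set where
  lc2 : ∀ {τ} → LimCond i2 τ
  lc0 : ∀ {τ} → τ < Ω → LimCond i0 τ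
  lc1 : ∀ {τ} → τ < Ω₂ → LimCond i1 τ

data Tp : Tm → Tm → Set where
  tp0    : Tp 𝟎 𝟎
  tp1    : Tp 𝟏 𝟏
  tpΩ    : ∀ {i} → Tp (ψ i 𝟎) (ψ i 𝟎)
  tpsum  : ∀ {l a τ} → Tp a τ → Tp (Σ (l ∷ʳ a)) τ
  tpsucc : ∀ {i α} → Tp α 𝟏 → Tp (ψ i α) ω
  tplim  : ∀ {i α τ} → Tp α τ → τ ≢ 𝟎 → τ ≢ 𝟏 → LimCond i τ → Tp (ψ i α) τ
  tpψ0Ω  : ∀ {α} → Tp α Ω → Tp (ψ i0 α) ω
  tpψ1Ω₂ : ∀ {α} → Tp α Ω₂ → Tp (ψ i1 α) ω

mutual
  data FS : Tm → Tm → Tm → Set where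
    fs0    : ∀ {x} → FS 𝟎 x 𝟎
    fs1    : ∀ {x} → FS 𝟏 x 𝟎
    fsΩ    : ∀ {i x} → FS (ψ i 𝟎) x x
    fssum  : ∀ {l a x b} → FS a x b → FS (Σ (l ∷ʳ a)) x (fromList (l ++ toList b))
    fssucc : ∀ {i α γ n} → Tp α 𝟏 → FS α 𝟎 γ → FS (ψ i α) (num n) (ψ i γ · n)
    fslim  : ∀ {i α τ x β} → Tp α τ → τ ≢ 𝟎 → τ ≢ 𝟏 → LimCond i τ
             → FS α x β → FS (ψ i α) x (ψ i β)
    fsψ0Ω  : ∀ {α n z β} → Tp α Ω → Z i0 α n z → FS α z β
             → FS (ψ i0 α) (num n) (ψ i0 β)
    fsψ1Ω₂ : ∀ {α n z β} → Tp α Ω₂ → Z i1 α n z → FS α z β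
             → FS (ψ i1 α) (num n) (ψ i1 β)

  -- Z i α n z :  z_n = z  where z_0 = 0, z_{n+1} = ψ_i(α[z_n])
  data Z : Ix → Tm → ℕ → Tm → Set where
    z0 : ∀ {i α} → Z i α 0 𝟎
    zs : ∀ {i α n z β} → Z i α n z → FS α z β → Z i α (suc n) (ψ i β)

-- Hardy hierarchy:  H α k v  means  H_α(k) = v;
-- Br λ k b μ  means  λ{b} = μ (for argument k).

mutual
  data H : Tm → ℕ → ℕ → Set where
    h0   : ∀ {k} → H 𝟎 k k
    hsuc : ∀ {α k v} → H α k v → H (succT α) k (v * k)
    hlim : ∀ {λ' k μ v} → Tp λ' ω → Br λ' k k μ → H μ k v → H λ' k v

  data Br : Tm → ℕ → ℕ → Tm → Set where
    br0 : ∀ {λ' k μ} → FS λ' 𝟎 μ → Br λ' k 0 μ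
    brs : ∀ {λ' k b μ v ν} → Br λ' k b μ → H μ k v → FS λ' (num v) ν
          → Br λ' k (suc b) ν

{-# OPTIONS --safe #-}
module Submission where

open import Defs
open import Data.Nat using (ℕ; _≤_; zero; suc; _+_; _*_; z≤n; s≤s)
open import Data.List using (List)
open import Data.List.Membership.Propositional using (_∈_)
open import Data.Product using (Σ-syntax; ∃-syntax; _×_; _,_; proj₂)

open import Level using (Level)
open import Data.Nat.Properties
open import Data.List using ([]; _∷_; _++_; _∷ʳ_; replicate; length; map; cartesianProductWith)
open import Data.List.Properties using (∷ʳ-injective)
open import Data.List.Relation.Unary.All using (All; []; _∷_)
open import Data.List.Relation.Unary.Any using (here; there)
open import Data.List.Membership.Propositional.Properties
  using (∈-map⁺; ∈-++⁺ˡ; ∈-++⁺ʳ; ∈-cartesianProductWith⁺)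
open import Relation.Nullary using (¬_)
open import Data.Empty using (⊥-elim)
open import Relation.Binary.PropositionalEquality using (_≡_; _≢_; refl; sym; trans; cong; subst; module ≡-Reasoning)

-- The norm of a term counts its symbols 1 and ψᵢ.  A successor step lowers
-- the norm by one while H multiplies by k ≥ 2, and the fundamental sequence of
-- a limit term at an argument of norm ≥ 2 never lowers the norm; hence
-- norm α + k ≤ H_α(k).  Since the sums of an OT term consist of principal
-- summands, its size is at most 2·norm α + 1, and there are only finitely many
-- terms of a given size.

private
  variable
    i : Ix
    k n v : ℕ
    a α β γ τ x z : Tm
    l : List Tm

mutual
  norm : Tm → ℕ
  norm 𝟎 = 0
  norm 𝟏 = 1
  norm (ψ i t) = suc (norm t)
  norm (Σ l) = normSum l

  normSum : List Tm → ℕ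
  normSum [] = 0
  normSum (t ∷ l) = norm t + normSum l

normSum-++ : ∀ l l′ → normSum (l ++ l′) ≡ normSum l + normSum l′
normSum-++ [] l′ = refl
normSum-++ (t ∷ l) l′ = trans (cong (norm t +_) (normSum-++ l l′)) (sym (+-assoc (norm t) _ _))

normSum-toList : ∀ t → normSum (toList t) ≡ norm t
normSum-toList 𝟎 = refl
normSum-toList 𝟏 = refl
normSum-toList (ψ i t) = +-identityʳ _
normSum-toList (Σ l) = refl

norm-fromList : ∀ l → norm (fromList l) ≡ normSum l
norm-fromList [] = refl
norm-fromList (t ∷ []) = sym (+-identityʳ (norm t))
norm-fromList (_ ∷ _ ∷ _) = refl

norm-· : ∀ t n → norm (t · n) ≡ n * norm t
norm-· t n = trans (norm-fromList (replicate n t)) (normSum-replicate n)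
  where
  normSum-replicate : ∀ n → normSum (replicate n t) ≡ n * norm t
  normSum-replicate zero = refl
  normSum-replicate (suc n) = cong (norm t +_) (normSum-replicate n)

norm-num : ∀ n → norm (num n) ≡ n
norm-num n = trans (norm-· 𝟏 n) (*-identityʳ n)

norm-succT : ∀ t → norm (succT t) ≡ norm t + 1
norm-succT t = begin
  norm (succT t)                    ≡⟨ norm-fromList (toList t ∷ʳ 𝟏) ⟩
  normSum (toList t ++ 𝟏 ∷ [])      ≡⟨ normSum-++ (toList t) (𝟏 ∷ []) ⟩
  normSum (toList t) + 1            ≡⟨ cong (_+ 1) (normSum-toList t) ⟩
  norm t + 1                        ∎
  where open ≡-Reasoning

norm-Σ-∷ʳ : ∀ l a → norm (Σ (l ∷ʳ a)) ≡ normSum l + norm a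
norm-Σ-∷ʳ l a = trans (normSum-++ l (a ∷ [])) (cong (normSum l +_) (+-identityʳ (norm a)))

norm-fromList-++-toList : ∀ l b → norm (fromList (l ++ toList b)) ≡ normSum l + norm b
norm-fromList-++-toList l b = begin
  norm (fromList (l ++ toList b))   ≡⟨ norm-fromList (l ++ toList b) ⟩
  normSum (l ++ toList b)           ≡⟨ normSum-++ l (toList b) ⟩
  normSum l + normSum (toList b)    ≡⟨ cong (normSum l +_) (normSum-toList b) ⟩
  normSum l + norm b                ∎
  where open ≡-Reasoning

Tp-Σ-last : ∀ l → Tp (Σ (l ∷ʳ a)) τ → Tp a τ
Tp-Σ-last l t = invert t refl
  where
  invert : ∀ {L} → Tp (Σ L) τ → L ≡ l ∷ʳ a → Tp a τ
  invert (tpsum {l′} t′) eq = subst (λ a → Tp a _) (proj₂ (∷ʳ-injective l′ l eq)) t′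

Tp-𝟎 : Tp 𝟎 τ → τ ≡ 𝟎
Tp-𝟎 tp0 = refl

Tp-𝟏 : Tp 𝟏 τ → τ ≡ 𝟏
Tp-𝟏 tp1 = refl

Tp-ψ≢𝟏 : ¬ Tp (ψ i α) 𝟏
Tp-ψ≢𝟏 (tplim _ _ τ≢𝟏 _) = τ≢𝟏 refl

FS-succ-norm : Tp α 𝟏 → FS α x γ → norm α ≡ suc (norm γ)
FS-succ-norm t fs1 = refl
FS-succ-norm t (fssum {l} {a} {b = b} f) = begin
  norm (Σ (l ∷ʳ a))                  ≡⟨ norm-Σ-∷ʳ l a ⟩
  normSum l + norm a                 ≡⟨ cong (normSum l +_) (FS-succ-norm (Tp-Σ-last l t) f) ⟩
  normSum l + suc (norm b)           ≡⟨ +-suc (normSum l) (norm b) ⟩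
  suc (normSum l + norm b)           ≡⟨ cong suc (norm-fromList-++-toList l b) ⟨
  suc (norm (fromList (l ++ toList b))) ∎
  where open ≡-Reasoning
FS-succ-norm t fsΩ = ⊥-elim (Tp-ψ≢𝟏 t)
FS-succ-norm t (fssucc _ _) = ⊥-elim (Tp-ψ≢𝟏 t)
FS-succ-norm t (fslim _ _ _ _ _) = ⊥-elim (Tp-ψ≢𝟏 t)
FS-succ-norm t (fsψ0Ω _ _ _) = ⊥-elim (Tp-ψ≢𝟏 t)
FS-succ-norm t (fsψ1Ω₂ _ _ _) = ⊥-elim (Tp-ψ≢𝟏 t)

FS-norm-positive : Tp α τ → τ ≢ 𝟎 → τ ≢ 𝟏 → 1 ≤ norm x → FS α x β → 1 ≤ norm β
FS-norm-positive t τ≢𝟎 _ _ fs0 = ⊥-elim (τ≢𝟎 (Tp-𝟎 t))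
FS-norm-positive t _ τ≢𝟏 _ fs1 = ⊥-elim (τ≢𝟏 (Tp-𝟏 t))
FS-norm-positive _ _ _ 1≤x fsΩ = 1≤x
FS-norm-positive t τ≢𝟎 τ≢𝟏 1≤x (fssum {l} {b = b} f) =
  subst (1 ≤_) (sym (norm-fromList-++-toList l b))
    (≤-trans (FS-norm-positive (Tp-Σ-last l t) τ≢𝟎 τ≢𝟏 1≤x f) (m≤n+m (norm b) (normSum l)))
FS-norm-positive _ _ _ 1≤x (fssucc {i} {γ = γ} {n} _ _) =
  subst (1 ≤_) (sym (norm-· (ψ i γ) n)) (*-mono-≤ (subst (1 ≤_) (norm-num n) 1≤x) (s≤s z≤n))
FS-norm-positive _ _ _ _ (fslim _ _ _ _ _) = s≤s z≤n
FS-norm-positive _ _ _ _ (fsψ0Ω _ _ _) = s≤s z≤n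
FS-norm-positive _ _ _ _ (fsψ1Ω₂ _ _ _) = s≤s z≤n

Z-norm≥2 : Tp α τ → τ ≢ 𝟎 → τ ≢ 𝟏 → Z i α n z → 2 ≤ n → 2 ≤ norm z
Z-norm≥2 _ _ _ (zs z0 _) (s≤s ())
Z-norm≥2 t τ≢𝟎 τ≢𝟏 (zs (zs _ _) f) _ = s≤s (FS-norm-positive t τ≢𝟎 τ≢𝟏 (s≤s z≤n) f)

2+m≤n*[1+m] : ∀ m → 2 ≤ n → 2 + m ≤ n * suc m
2+m≤n*[1+m] {n} m 2≤n = begin
  2 + m            ≤⟨ s≤s (m≤n+m (suc m) m) ⟩
  suc (m + suc m)  ≡⟨ cong (suc m +_) (+-identityʳ (suc m)) ⟨
  2 * suc m        ≤⟨ *-monoˡ-≤ (suc m) 2≤n ⟩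
  n * suc m        ∎
  where open ≤-Reasoning

FS-norm-mono : Tp α τ → τ ≢ 𝟏 → 2 ≤ norm x → FS α x β → norm α ≤ norm β
FS-norm-mono _ _ _ fs0 = z≤n
FS-norm-mono t τ≢𝟏 _ fs1 = ⊥-elim (τ≢𝟏 (Tp-𝟏 t))
FS-norm-mono _ _ 2≤x fsΩ = ≤-trans (s≤s z≤n) 2≤x
FS-norm-mono t τ≢𝟏 2≤x (fssum {l} {a} {b = b} f) = begin
  norm (Σ (l ∷ʳ a))                  ≡⟨ norm-Σ-∷ʳ l a ⟩
  normSum l + norm a                 ≤⟨ +-monoʳ-≤ (normSum l) (FS-norm-mono (Tp-Σ-last l t) τ≢𝟏 2≤x f) ⟩
  normSum l + norm b                 ≡⟨ norm-fromList-++-toList l b ⟨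
  norm (fromList (l ++ toList b))    ∎
  where open ≤-Reasoning
FS-norm-mono _ _ 2≤x (fssucc {i} {α} {γ} {n} t f) = begin
  suc (norm α)     ≡⟨ cong suc (FS-succ-norm t f) ⟩
  2 + norm γ       ≤⟨ 2+m≤n*[1+m] (norm γ) (subst (2 ≤_) (norm-num n) 2≤x) ⟩
  n * norm (ψ i γ) ≡⟨ norm-· (ψ i γ) n ⟨
  norm (ψ i γ · n) ∎
  where open ≤-Reasoning
FS-norm-mono _ _ 2≤x (fslim t _ τ≢𝟏 _ f) = s≤s (FS-norm-mono t τ≢𝟏 2≤x f)
FS-norm-mono _ _ 2≤x (fsψ0Ω {n = n} t zₙ f) =
  s≤s (FS-norm-mono t (λ ()) (Z-norm≥2 t (λ ()) (λ ()) zₙ (subst (2 ≤_) (norm-num n) 2≤x)) f)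
FS-norm-mono _ _ 2≤x (fsψ1Ω₂ {n = n} t zₙ f) =
  s≤s (FS-norm-mono t (λ ()) (Z-norm≥2 t (λ ()) (λ ()) zₙ (subst (2 ≤_) (norm-num n) 2≤x)) f)

norm+k≤H : 2 ≤ k → H α k v → norm α + k ≤ v
norm+k≤H _ h0 = ≤-refl
norm+k≤H {k} 2≤k (hsuc {α} {v = v} h) = begin
  norm (succT α) + k  ≡⟨ cong (_+ k) (norm-succT α) ⟩
  norm α + 1 + k      ≡⟨ +-assoc (norm α) 1 k ⟩
  norm α + suc k      ≡⟨ +-suc (norm α) k ⟩
  suc (norm α + k)    ≤⟨ s≤s norm+k≤v ⟩
  1 + v               ≤⟨ +-monoˡ-≤ v 1≤v ⟩
  v + v               ≡⟨ cong (v +_) (+-identityʳ v) ⟨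
  2 * v               ≤⟨ *-monoˡ-≤ v 2≤k ⟩
  k * v               ≡⟨ *-comm k v ⟩
  v * k               ∎
  where
  open ≤-Reasoning
  norm+k≤v : norm α + k ≤ v
  norm+k≤v = norm+k≤H 2≤k h
  1≤v : 1 ≤ v
  1≤v = ≤-trans (≤-trans (s≤s z≤n) 2≤k) (≤-trans (m≤n+m k (norm α)) norm+k≤v)
norm+k≤H () (hlim _ (br0 _) _)
norm+k≤H {k} 2≤k (hlim {λ'} {μ = μ} tω (brs {μ = μ′} {v = v′} _ h′ f) h) = begin
  norm λ' + k  ≤⟨ +-monoˡ-≤ k (FS-norm-mono tω (λ ()) 2≤num f) ⟩
  norm μ + k   ≤⟨ norm+k≤H 2≤k h ⟩
  _            ∎
  where
  open ≤-Reasoning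
  2≤num : 2 ≤ norm (num v′)
  2≤num = subst (2 ≤_) (sym (norm-num v′))
    (≤-trans 2≤k (≤-trans (m≤n+m k (norm μ′)) (norm+k≤H 2≤k h′)))

mutual
  size : Tm → ℕ
  size 𝟎 = 1
  size 𝟏 = 1
  size (ψ i t) = suc (size t)
  size (Σ l) = suc (sizeSum l)

  sizeSum : List Tm → ℕ
  sizeSum [] = 0
  sizeSum (t ∷ l) = size t + sizeSum l

size-ψ : ∀ i → size β ≤ suc (2 * norm β) → size (ψ i β) ≤ 2 * norm (ψ i β)
size-ψ {β} _ size≤ = ≤-trans (s≤s size≤) (≤-reflexive (sym (*-suc 2 (norm β))))

mutual
  size-OT : OT α → size α ≤ suc (2 * norm α)
  size-OT ot0 = s≤s z≤n
  size-OT ot1 = s≤s z≤n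
  size-OT o@(otψ2 _) = m≤n⇒m≤1+n (size-principal pψ o)
  size-OT o@(otψ1 _ _) = m≤n⇒m≤1+n (size-principal pψ o)
  size-OT o@(otψ0 _ _ _) = m≤n⇒m≤1+n (size-principal pψ o)
  size-OT (otsum _ ps _ os) = s≤s (sizeSum-principal ps os)

  size-principal : Principal α → OT α → size α ≤ 2 * norm α
  size-principal p1 _ = s≤s z≤n
  size-principal pψ (otψ2 o) = size-ψ i2 (size-OT o)
  size-principal pψ (otψ1 o _) = size-ψ i1 (size-OT o)
  size-principal pψ (otψ0 o _ _) = size-ψ i0 (size-OT o)

  sizeSum-principal : All Principal l → All OT l → sizeSum l ≤ 2 * normSum l
  sizeSum-principal [] [] = z≤n
  sizeSum-principal {t ∷ l} (p ∷ ps) (o ∷ os) = begin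
    size t + sizeSum l            ≤⟨ +-mono-≤ (size-principal p o) (sizeSum-principal ps os) ⟩
    2 * norm t + 2 * normSum l    ≡⟨ *-distribˡ-+ 2 (norm t) (normSum l) ⟨
    2 * (norm t + normSum l)      ∎
    where open ≤-Reasoning

module _ {a : Level} {A : Set a} where

  listsOfLength≤ : ℕ → List A → List (List A)
  listsOfLength≤ zero xs = [] ∷ []
  listsOfLength≤ (suc n) xs = [] ∷ cartesianProductWith _∷_ xs (listsOfLength≤ n xs)

  ∈-listsOfLength≤ : ∀ {n xs} (ys : List A) → length ys ≤ n → All (_∈ xs) ys → ys ∈ listsOfLength≤ n xs
  ∈-listsOfLength≤ {zero} [] _ _ = here refl
  ∈-listsOfLength≤ {suc n} [] _ _ = here refl
  ∈-listsOfLength≤ {suc n} (y ∷ ys) (s≤s len≤n) (y∈xs ∷ ys⊆xs) =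
    there (∈-cartesianProductWith⁺ _∷_ y∈xs (∈-listsOfLength≤ ys len≤n ys⊆xs))

indices : List Ix
indices = i0 ∷ i1 ∷ i2 ∷ []

∈-indices : ∀ i → i ∈ indices
∈-indices i0 = here refl
∈-indices i1 = there (here refl)
∈-indices i2 = there (there (here refl))

termsOfSize≤ : ℕ → List Tm
termsOfSize≤ zero = []
termsOfSize≤ (suc n) =
  𝟎 ∷ 𝟏 ∷ cartesianProductWith ψ indices (termsOfSize≤ n) ++ map Σ (listsOfLength≤ n (termsOfSize≤ n))

length≤sizeSum : ∀ l → length l ≤ sizeSum l
length≤sizeSum [] = z≤n
length≤sizeSum (t ∷ l) = +-mono-≤ (1≤size t) (length≤sizeSum l)
  where
  1≤size : ∀ t → 1 ≤ size t
  1≤size 𝟎 = s≤s z≤n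
  1≤size 𝟏 = s≤s z≤n
  1≤size (ψ _ _) = s≤s z≤n
  1≤size (Σ _) = s≤s z≤n

mutual
  ∈-termsOfSize≤ : ∀ n t → size t ≤ n → t ∈ termsOfSize≤ n
  ∈-termsOfSize≤ (suc n) 𝟎 _ = here refl
  ∈-termsOfSize≤ (suc n) 𝟏 _ = there (here refl)
  ∈-termsOfSize≤ (suc n) (ψ i t) (s≤s size≤n) =
    there (there (∈-++⁺ˡ (∈-cartesianProductWith⁺ ψ (∈-indices i) (∈-termsOfSize≤ n t size≤n))))
  ∈-termsOfSize≤ (suc n) (Σ l) (s≤s size≤n) =
    there (there (∈-++⁺ʳ (cartesianProductWith ψ indices (termsOfSize≤ n))
      (∈-map⁺ Σ (∈-listsOfLength≤ l (≤-trans (length≤sizeSum l) size≤n) (All-∈-termsOfSize≤ n l size≤n)))))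

  All-∈-termsOfSize≤ : ∀ n l → sizeSum l ≤ n → All (_∈ termsOfSize≤ n) l
  All-∈-termsOfSize≤ n [] _ = []
  All-∈-termsOfSize≤ n (t ∷ l) size≤n =
    ∈-termsOfSize≤ n t (≤-trans (m≤m+n (size t) (sizeSum l)) size≤n)
    ∷ All-∈-termsOfSize≤ n l (≤-trans (m≤n+m (sizeSum l) (size t)) size≤n)

mainTheorem14 : (k : ℕ) → 2 ≤ k → (m : ℕ) →
    Σ[ L ∈ List Tm ] (∀ α → OT₀ α → α < Ω → (∃[ v ] (H α k v × v ≤ m)) → α ∈ L)
mainTheorem14 k 2≤k m = termsOfSize≤ (suc (2 * m)) , bounded
  where
  bounded : ∀ α → OT₀ α → α < Ω → (∃[ v ] (H α k v × v ≤ m)) → α ∈ termsOfSize≤ (suc (2 * m))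
  bounded α (ot , _) _ (v , h , v≤m) = ∈-termsOfSize≤ (suc (2 * m)) α (begin
    size α               ≤⟨ size-OT ot ⟩
    suc (2 * norm α)     ≤⟨ s≤s (*-monoʳ-≤ 2 norm≤m) ⟩
    suc (2 * m)          ∎)
    where
    open ≤-Reasoning
    norm≤m : norm α ≤ m
    norm≤m = ≤-trans (m≤m+n (norm α) k) (≤-trans (norm+k≤H 2≤k h) v≤m)
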